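{- For the complete bipartite graph $K_{p,q}$ with $1\le p\le q$, $$\mathrm{msd}(K_{p,q})=\begin{cases}1 & \text{if } p=1 \text{ and } q>1,\\ 2 & \text{if } p=q=1,\\ 3 & \text{if } p\ge 2.\end{cases}$$
   Context: $\gamma(G)$ is the domination number of $G$ (minimum size of a set $D\subseteq V(G)$ such that every vertex outside $D$ has a neighbour in $D$). For an edge $e=uv$ and $t\ge1$, $G_{e,t}$ is the graph obtained by replacing $e$ by a path with $t$ new internal vertices. $\mathrm{msd}(uv)$ is the minimum positive integer $t$ with $\gamma(G_{uv,t})>\gamma(G)$, and $\mathrm{msd}(G)=\min_{uv\in E(G)}\mathrm{msd}(uv)$. -}

module Defs where

import Data.Nat
open import Data.Nat using (ℕ; zero; suc; _+_; _≤_; _<_)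
open import Data.Fin using (Fin; toℕ; splitAt)
open import Data.Fin.Subset using (Subset; _∈_; ∣_∣)
open import Data.Sum using (_⊎_; inj₁; inj₂)
open import Data.Product using (Σ; ∃; _×_; _,_)
open import Relation.Nullary using (¬_)
open import Relation.Binary.PropositionalEquality using (_≡_; _≢_; refl)
import Relation.Binary.PropositionalEquality as Eq

record Graph : Set₁ where
  field
    n     : ℕ
    Adj   : Fin n → Fin n → Set
    sym   : ∀ {x y} → Adj x y → Adj y x
    irrefl : ∀ {x} → ¬ Adj x x
open Graph public

Dominating : (G : Graph) → Subset (n G) → Set
Dominating G D = ∀ v → ¬ (v ∈ D) → ∃ λ u → u ∈ D × Adj G u v

IsDomNum : Graph → ℕ → Set
IsDomNum G k =
  (Σ (Subset (n G)) λ D → Dominating G D × ∣ D ∣ ≡ k) ×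
  (∀ D → Dominating G D → k ≤ ∣ D ∣)

-- Adjacency of G_{uv,t}: vertex set Fin (n + t); the first n vertices are
-- the original ones, vertex (n + i) is the i-th new internal vertex w_i of the
-- path u - w_0 - w_1 - ... - w_{t-1} - v replacing the edge uv.
SubAdjSplit : (G : Graph) (u v : Fin (n G)) (t : ℕ) →
              Fin (n G) ⊎ Fin t → Fin (n G) ⊎ Fin t → Set
SubAdjSplit G u v t (inj₁ a) (inj₁ b) =
  Adj G a b × ¬ ((a ≡ u × b ≡ v) ⊎ (a ≡ v × b ≡ u))
SubAdjSplit G u v t (inj₁ a) (inj₂ i) =
  (a ≡ u × toℕ i ≡ 0) ⊎ (a ≡ v × suc (toℕ i) ≡ t)
SubAdjSplit G u v t (inj₂ i) (inj₁ a) =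
  (a ≡ u × toℕ i ≡ 0) ⊎ (a ≡ v × suc (toℕ i) ≡ t)
SubAdjSplit G u v t (inj₂ i) (inj₂ j) =
  (toℕ j ≡ suc (toℕ i)) ⊎ (toℕ i ≡ suc (toℕ j))

private
  n≢1+n : ∀ m → m ≢ suc m
  n≢1+n zero ()
  n≢1+n (suc m) e = n≢1+n m (Eq.cong Data.Nat.pred e)

  sub-sym : ∀ G u v t x y → SubAdjSplit G u v t x y → SubAdjSplit G u v t y x
  sub-sym G u v t (inj₁ a) (inj₁ b) (e , ne) =
    sym G e , λ { (inj₁ (p , q)) → ne (inj₂ (q , p)) ; (inj₂ (p , q)) → ne (inj₁ (q , p)) }
  sub-sym G u v t (inj₁ a) (inj₂ i) h = h
  sub-sym G u v t (inj₂ i) (inj₁ a) h = h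
  sub-sym G u v t (inj₂ i) (inj₂ j) (inj₁ p) = inj₂ p
  sub-sym G u v t (inj₂ i) (inj₂ j) (inj₂ p) = inj₁ p

  sub-irr : ∀ G u v t x → ¬ SubAdjSplit G u v t x x
  sub-irr G u v t (inj₁ a) (e , _) = irrefl G e
  sub-irr G u v t (inj₂ i) (inj₁ p) = n≢1+n _ p
  sub-irr G u v t (inj₂ i) (inj₂ p) = n≢1+n _ p

Subdivide : (G : Graph) → Fin (n G) → Fin (n G) → ℕ → Graph
Subdivide G u v t = record
  { n = n G + t
  ; Adj = λ x y → SubAdjSplit G u v t (splitAt (n G) x) (splitAt (n G) y)
  ; sym = λ {x} {y} → sub-sym G u v t (splitAt (n G) x) (splitAt (n G) y)
  ; irrefl = λ {x} → sub-irr G u v t (splitAt (n G) x)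
  }

GammaIncreases : Graph → Graph → Set
GammaIncreases H G = Σ ℕ λ a → Σ ℕ λ b → IsDomNum H a × IsDomNum G b × b < a

GammaNotIncreased : Graph → Graph → Set
GammaNotIncreased H G = Σ ℕ λ a → Σ ℕ λ b → IsDomNum H a × IsDomNum G b × a ≤ b

IsMsdEdge : (G : Graph) → Fin (n G) → Fin (n G) → ℕ → Set
IsMsdEdge G u v m =
  1 ≤ m × GammaIncreases (Subdivide G u v m) G ×
  (∀ s → 1 ≤ s → s < m → GammaNotIncreased (Subdivide G u v s) G)

IsMsd : Graph → ℕ → Set
IsMsd G m =
  (Σ (Fin (n G)) λ u → Σ (Fin (n G)) λ v → Adj G u v × IsMsdEdge G u v m) ×
  (∀ u v → Adj G u v → ∀ s → 1 ≤ s → s < m →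
     GammaNotIncreased (Subdivide G u v s) G)

data Side : Set where
  A B : Side

side : ∀ p q → Fin (p + q) → Side
side p q x with splitAt p x
... | inj₁ _ = A
... | inj₂ _ = B

K : ℕ → ℕ → Graph
K p q = record
  { n = p + q
  ; Adj = λ x y → side p q x ≢ side p q y
  ; sym = λ ne e → ne (Eq.sym e)
  ; irrefl = λ ne → ne refl
  }

-- γ(H) = k is shown by a dominating list of k vertices together with the fact that every shorter
-- list leaves some vertex undominated. For p, q ≥ 2 only two properties of K_{p,q} matter: the
-- ends of any edge dominate, and every vertex has a non-neighbour (on its own side); so γ = 2.
-- Subdividing an edge uv once or twice keeps u, v dominating, while after three subdivisions any
-- two vertices have a common non-neighbour: a vertex off uv for two path vertices, the middle path
-- vertex for two original ones, and for a path vertex and an original one either the opposite end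
-- of the path or a non-neighbour in K_{p,q}; so γ = 3. In K_{1,q} the centre dominates, but after
-- one subdivision of an edge every vertex has a non-neighbour. K_{1,1} is P₂, with γ(P₃) = 1 and
-- γ(P₄) = 2.
module Submission where

open import Defs
open import Data.Nat using (ℕ; zero; suc; _+_; _≤_; _<_; z≤n; s≤s; _≤?_)
open import Data.Nat.Properties using (≤-refl; ≤-trans; ≤-antisym; ≤-pred; ≰⇒>; +-suc; +-mono-≤; n≤1+n)
open import Data.Fin using (Fin; zero; suc; toℕ; join; _↑ʳ_)
open import Data.Fin.Properties using (_≟_; splitAt-join; join-splitAt; splitAt-↑ʳ; ↑ʳ-injective)
open import Data.Fin.Subset using (Subset; inside; outside; ⁅_⁆; _∪_; ⋃; ∣_∣) renaming (_∈_ to _∈ₛ_)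
open import Data.Fin.Subset.Properties using (_∈?_; x∈⁅x⁆; x∈p∪q⁺; ∣⁅x⁆∣≡1; ∣⊥∣≡0)
open import Data.Vec.Base using ([]; _∷_; here; there)
open import Data.List using (List; []; _∷_; length; map)
open import Data.List.Properties using (length-map)
open import Data.List.Membership.Propositional using (_∈_; _∉_)
open import Data.List.Membership.Propositional.Properties using (∈-map⁺)
open import Data.List.Relation.Unary.Any using (here; there)
open import Data.List.Relation.Unary.All as All using (All; []; _∷_)
open import Data.List.Relation.Unary.All.Properties using (map⁻)
open import Data.Sum using (_⊎_; inj₁; inj₂)
open import Data.Sum.Properties using (inj₁-injective)
open import Data.Product using (∃; ∃-syntax; ∃₂; _×_; _,_; proj₁; proj₂; map₂)
open import Function using (_∘_)
open import Relation.Nullary using (¬_; yes; no; contradiction)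
open import Relation.Nullary.Decidable using (decidable-stable)
open import Relation.Binary.PropositionalEquality using (_≡_; _≢_; refl; trans; cong; subst)
  renaming (sym to ≡-sym)

module _ {V : Set} (E : V → V → Set) where

  DominatingList : List V → Set
  DominatingList ds = ∀ z → z ∈ ds ⊎ ∃[ d ] d ∈ ds × E d z

  NoDominatingListBelow : ℕ → Set
  NoDominatingListBelow k =
    ∀ ds → length ds < k → ∃[ w ] w ∉ ds × All (λ d → ¬ E d w) ds

  NonNeighbour : V → V → Set
  NonNeighbour x w = w ≢ x × ¬ E x w

  CommonNonNeighbour : V → V → V → Set
  CommonNonNeighbour x y w = NonNeighbour x w × NonNeighbour y w

  noDominatingListBelow-1 : V → NoDominatingListBelow 1
  noDominatingListBelow-1 w []      _       = w , (λ ()) , []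
  noDominatingListBelow-1 _ (_ ∷ _) (s≤s ())

  noDominatingListBelow-2 : V → (∀ x → ∃ (NonNeighbour x)) → NoDominatingListBelow 2
  noDominatingListBelow-2 w _ [] _ = w , (λ ()) , []
  noDominatingListBelow-2 _ nonNeighbour (x ∷ []) _ with nonNeighbour x
  ... | w , w≢x , ¬xw = w , (λ { (here w≡x) → w≢x w≡x ; (there ()) }) , ¬xw ∷ []
  noDominatingListBelow-2 _ _ (_ ∷ _ ∷ _) (s≤s (s≤s ()))

  noDominatingListBelow-3 : V → (∀ x y → ∃ (CommonNonNeighbour x y)) → NoDominatingListBelow 3
  noDominatingListBelow-3 w _ [] _ = w , (λ ()) , []
  noDominatingListBelow-3 _ common (x ∷ []) _ with common x x
  ... | w , (w≢x , ¬xw) , _ = w , (λ { (here w≡x) → w≢x w≡x ; (there ()) }) , ¬xw ∷ []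
  noDominatingListBelow-3 _ common (x ∷ y ∷ []) _ with common x y
  ... | w , (w≢x , ¬xw) , (w≢y , ¬yw) =
    w , (λ { (here w≡x) → w≢x w≡x ; (there (here w≡y)) → w≢y w≡y ; (there (there ())) }) ,
    ¬xw ∷ ¬yw ∷ []
  noDominatingListBelow-3 _ _ (_ ∷ _ ∷ _ ∷ _) (s≤s (s≤s (s≤s ())))

module _ {V W : Set} (E : V → V → Set) {to : W → V} {from : V → W}
         (to∘from : ∀ v → to (from v) ≡ v) (from∘to : ∀ w → from (to w) ≡ w) where

  dominatingList-transport : ∀ {ds} → DominatingList E ds →
    DominatingList (λ x y → E (to x) (to y)) (map from ds)
  dominatingList-transport {ds} dom z with dom (to z)
  ... | inj₁ tz∈ds = inj₁ (subst (_∈ map from ds) (from∘to z) (∈-map⁺ from tz∈ds))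
  ... | inj₂ (d , d∈ds , e) =
    inj₂ (from d , ∈-map⁺ from d∈ds , subst (λ x → E x (to z)) (≡-sym (to∘from d)) e)

  noDominatingListBelow-transport : ∀ {k} → NoDominatingListBelow E k →
    NoDominatingListBelow (λ x y → E (to x) (to y)) k
  noDominatingListBelow-transport {k} noDom xs len
    with noDom (map to xs) (subst (_< k) (≡-sym (length-map to xs)) len)
  ... | w , w∉ , nonAdj =
    from w ,
    (λ fw∈xs → w∉ (subst (_∈ map to xs) (to∘from w) (∈-map⁺ to fw∈xs))) ,
    All.map (λ {x} ¬e → ¬e ∘ subst (E (to x)) (to∘from w)) (map⁻ nonAdj)

∣p∪q∣≤∣p∣+∣q∣ : ∀ {m} (p q : Subset m) → ∣ p ∪ q ∣ ≤ ∣ p ∣ + ∣ q ∣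
∣p∪q∣≤∣p∣+∣q∣ [] [] = z≤n
∣p∪q∣≤∣p∣+∣q∣ (inside ∷ p) (inside ∷ q) =
  s≤s (≤-trans (∣p∪q∣≤∣p∣+∣q∣ p q) (+-mono-≤ (≤-refl {∣ p ∣}) (n≤1+n ∣ q ∣)))
∣p∪q∣≤∣p∣+∣q∣ (inside ∷ p) (outside ∷ q) = s≤s (∣p∪q∣≤∣p∣+∣q∣ p q)
∣p∪q∣≤∣p∣+∣q∣ (outside ∷ p) (inside ∷ q) =
  subst (suc ∣ p ∪ q ∣ ≤_) (≡-sym (+-suc ∣ p ∣ ∣ q ∣)) (s≤s (∣p∪q∣≤∣p∣+∣q∣ p q))
∣p∪q∣≤∣p∣+∣q∣ (outside ∷ p) (outside ∷ q) = ∣p∪q∣≤∣p∣+∣q∣ p q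

fromList : ∀ {m} → List (Fin m) → Subset m
fromList xs = ⋃ (map ⁅_⁆ xs)

∣fromList∣≤length : ∀ {m} (xs : List (Fin m)) → ∣ fromList xs ∣ ≤ length xs
∣fromList∣≤length {m} [] = subst (_≤ 0) (≡-sym (∣⊥∣≡0 m)) z≤n
∣fromList∣≤length (x ∷ xs) = ≤-trans (∣p∪q∣≤∣p∣+∣q∣ ⁅ x ⁆ (fromList xs))
  (subst (λ c → c + ∣ fromList xs ∣ ≤ suc (length xs)) (≡-sym (∣⁅x⁆∣≡1 x))
         (s≤s (∣fromList∣≤length xs)))

∈-fromList⁺ : ∀ {m} {x : Fin m} {xs} → x ∈ xs → x ∈ₛ fromList xs
∈-fromList⁺ {x = x} (here refl) = x∈p∪q⁺ (inj₁ (x∈⁅x⁆ x))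
∈-fromList⁺ (there x∈xs) = x∈p∪q⁺ (inj₂ (∈-fromList⁺ x∈xs))

elements : ∀ {m} (D : Subset m) → ∃[ xs ] length xs ≡ ∣ D ∣ × (∀ {z} → z ∈ₛ D → z ∈ xs)
elements [] = [] , refl , λ ()
elements (inside ∷ D) with elements D
... | xs , len , ⊆xs = zero ∷ map suc xs , cong suc (trans (length-map suc xs) len) ,
  λ { here → here refl ; (there z∈D) → there (∈-map⁺ suc (⊆xs z∈D)) }
elements (outside ∷ D) with elements D
... | xs , len , ⊆xs = map suc xs , trans (length-map suc xs) len ,
  λ { (there z∈D) → ∈-map⁺ suc (⊆xs z∈D) }

module _ (G : Graph) where

  fromList-dominating : ∀ {ds} → DominatingList (Adj G) ds → Dominating G (fromList ds)
  fromList-dominating dom w w∉D with dom w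
  ... | inj₁ w∈ds = contradiction (∈-fromList⁺ w∈ds) w∉D
  ... | inj₂ (d , d∈ds , d~w) = d , ∈-fromList⁺ d∈ds , d~w

  undominated⇒¬dominating : ∀ {D es w} → (∀ {z} → z ∈ₛ D → z ∈ es) →
    w ∉ es → All (λ d → ¬ Adj G d w) es → ¬ Dominating G D
  undominated⇒¬dominating {D} {w = w} ⊆es w∉es nonAdj dom with w ∈? D
  ... | yes w∈D = w∉es (⊆es w∈D)
  ... | no w∉D with dom w w∉D
  ...   | d , d∈D , d~w = All.lookup nonAdj (⊆es d∈D) d~w

  ≤∣dominating∣ : ∀ {k D} → NoDominatingListBelow (Adj G) k → Dominating G D → k ≤ ∣ D ∣
  ≤∣dominating∣ {k} {D} noDom dom = decidable-stable (k ≤? ∣ D ∣) λ k≰∣D∣ →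
    let es , len , ⊆es = elements D
        w , w∉es , nonAdj = noDom es (subst (_< k) (≡-sym len) (≰⇒> k≰∣D∣))
    in undominated⇒¬dominating ⊆es w∉es nonAdj dom

  isDomNum : ∀ {k} ds → DominatingList (Adj G) ds → length ds ≤ k →
    NoDominatingListBelow (Adj G) k → IsDomNum G k
  isDomNum ds dom len noDom =
    (fromList ds , fromList-dominating dom ,
      ≤-antisym (≤-trans (∣fromList∣≤length ds) len) (≤∣dominating∣ noDom (fromList-dominating dom))) ,
    λ D → ≤∣dominating∣ noDom

  universal-dominates : ∀ {c} → (∀ z → z ≢ c → Adj G c z) → ∀ ds → DominatingList (Adj G) (c ∷ ds)
  universal-dominates {c} c~ ds z with z ≟ c
  ... | yes refl = inj₁ (here refl)
  ... | no z≢c = inj₂ (c , here refl , c~ z z≢c)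

  universal⇒γ≡1 : ∀ {c} → (∀ z → z ≢ c → Adj G c z) → IsDomNum G 1
  universal⇒γ≡1 {c} c~ = isDomNum (c ∷ []) (universal-dominates c~ []) ≤-refl (noDominatingListBelow-1 _ c)

-- Adj (Subdivide G u v t) is SubAdjSplit read through splitAt, so everything can be done on
-- Fin (n G) ⊎ Fin t and transported along join.
subdivision-isDomNum : ∀ (G : Graph) u v t {k} ds → DominatingList (SubAdjSplit G u v t) ds →
  length ds ≤ k → NoDominatingListBelow (SubAdjSplit G u v t) k → IsDomNum (Subdivide G u v t) k
subdivision-isDomNum G u v t ds dom len noDom =
  isDomNum (Subdivide G u v t) (map (join (n G) t) ds)
    (dominatingList-transport _ (splitAt-join (n G) t) (join-splitAt (n G) t) dom)
    (subst (_≤ _) (≡-sym (length-map _ ds)) len)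
    (noDominatingListBelow-transport _ (splitAt-join (n G) t) (join-splitAt (n G) t) noDom)

isMsd : ∀ {G : Graph} {m u v} → Adj G u v → 1 ≤ m → GammaIncreases (Subdivide G u v m) G →
  (∀ x y → Adj G x y → ∀ s → 1 ≤ s → s < m → GammaNotIncreased (Subdivide G x y s) G) →
  IsMsd G m
isMsd uv 1≤m increases below = (_ , _ , uv , 1≤m , increases , below _ _ uv) , below

nextToEnd : ∀ {t} → t ≤ 2 → (i : Fin t) → toℕ i ≡ 0 ⊎ suc (toℕ i) ≡ t
nextToEnd _                  zero          = inj₁ refl
nextToEnd (s≤s (s≤s z≤n))    (suc zero)    = inj₂ refl
nextToEnd (s≤s (s≤s z≤n))    (suc (suc ()))

module _ (G : Graph) {u v : Fin (n G)} where

  kept-edge : ∀ {t d z} → z ≢ u → z ≢ v → Adj G d z → SubAdjSplit G u v t (inj₁ d) (inj₁ z)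
  kept-edge z≢u z≢v d~z = d~z , λ { (inj₁ (_ , z≡v)) → z≢v z≡v ; (inj₂ (_ , z≡u)) → z≢u z≡u }

  kept-nonNeighbour : ∀ {t o o'} → NonNeighbour (Adj G) o o' →
    NonNeighbour (SubAdjSplit G u v t) (inj₁ o) (inj₁ o')
  kept-nonNeighbour (o'≢o , ¬o~o') = o'≢o ∘ inj₁-injective , ¬o~o' ∘ proj₁

  internal-nonAdjacent : ∀ {t o} (i : Fin t) → o ≢ u → o ≢ v → ¬ SubAdjSplit G u v t (inj₂ i) (inj₁ o)
  internal-nonAdjacent i o≢u o≢v (inj₁ (o≡u , _)) = o≢u o≡u
  internal-nonAdjacent i o≢u o≢v (inj₂ (o≡v , _)) = o≢v o≡v

  inj₁-∈ : ∀ {t x} {es : List (Fin (n G) ⊎ Fin t)} → x ∈ u ∷ v ∷ [] → inj₁ x ∈ inj₁ u ∷ inj₁ v ∷ es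
  inj₁-∈ (here refl)         = here refl
  inj₁-∈ (there (here refl)) = there (here refl)

  originals-dominated : DominatingList (Adj G) (u ∷ v ∷ []) → ∀ {t} es z →
    inj₁ z ∈ inj₁ u ∷ inj₁ v ∷ es ⊎
    ∃[ d ] d ∈ inj₁ u ∷ inj₁ v ∷ es × SubAdjSplit G u v t d (inj₁ z)
  originals-dominated dom {t} es z with dom z
  ... | inj₁ z∈ends = inj₁ (inj₁-∈ z∈ends)
  ... | inj₂ (d , d∈ends , d~z) with z ≟ u | z ≟ v
  ...   | yes refl | _        = inj₁ (here refl)
  ...   | no _     | yes refl = inj₁ (there (here refl))
  ...   | no z≢u   | no z≢v   = inj₂ (inj₁ d , inj₁-∈ d∈ends , kept-edge {t} z≢u z≢v d~z)

  ends-dominate-subdivision : DominatingList (Adj G) (u ∷ v ∷ []) → ∀ {t} → t ≤ 2 →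
    DominatingList (SubAdjSplit G u v t) (inj₁ u ∷ inj₁ v ∷ [])
  ends-dominate-subdivision dom t≤2 (inj₁ z) = originals-dominated dom [] z
  ends-dominate-subdivision dom t≤2 (inj₂ i) with nextToEnd t≤2 i
  ... | inj₁ i≡0   = inj₂ (inj₁ u , here refl , inj₁ (refl , i≡0))
  ... | inj₂ i+1≡t = inj₂ (inj₁ v , there (here refl) , inj₂ (refl , i+1≡t))

  ends-and-middle-dominate-subdivision₃ : DominatingList (Adj G) (u ∷ v ∷ []) →
    DominatingList (SubAdjSplit G u v 3) (inj₁ u ∷ inj₁ v ∷ inj₂ (suc zero) ∷ [])
  ends-and-middle-dominate-subdivision₃ dom (inj₁ z) = originals-dominated dom _ z
  ends-and-middle-dominate-subdivision₃ dom (inj₂ zero) = inj₂ (inj₁ u , here refl , inj₁ (refl , refl))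
  ends-and-middle-dominate-subdivision₃ dom (inj₂ (suc zero)) = inj₁ (there (there (here refl)))
  ends-and-middle-dominate-subdivision₃ dom (inj₂ (suc (suc zero))) =
    inj₂ (inj₁ v , there (here refl) , inj₂ (refl , refl))

  middle-dominates-subdivision₁ : (∀ z → z ≡ u ⊎ z ≡ v) →
    DominatingList (SubAdjSplit G u v 1) (inj₂ zero ∷ [])
  middle-dominates-subdivision₁ ends (inj₂ zero) = inj₁ (here refl)
  middle-dominates-subdivision₁ ends (inj₁ z) with ends z
  ... | inj₁ refl = inj₂ (inj₂ zero , here refl , inj₁ (refl , refl))
  ... | inj₂ refl = inj₂ (inj₂ zero , here refl , inj₂ (refl , refl))

  subdivision-nonNeighbours : ∀ {t o₃} → o₃ ≢ u → o₃ ≢ v →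
    (∀ o → ∃[ o' ] NonNeighbour (SubAdjSplit G u v t) (inj₁ o) (inj₁ o')) →
    ∀ x → ∃ (NonNeighbour (SubAdjSplit G u v t) x)
  subdivision-nonNeighbours o₃≢u o₃≢v originals (inj₁ o) with originals o
  ... | o' , o'-nonNeighbour = inj₁ o' , o'-nonNeighbour
  subdivision-nonNeighbours {o₃ = o₃} o₃≢u o₃≢v originals (inj₂ i) =
    inj₁ o₃ , (λ ()) , internal-nonAdjacent i o₃≢u o₃≢v

  private
    w₁-far-from-originals : ∀ a → NonNeighbour (SubAdjSplit G u v 3) (inj₁ a) (inj₂ (suc zero))
    w₁-far-from-originals a = (λ ()) , λ { (inj₁ (_ , ())) ; (inj₂ (_ , ())) }

    internal-original-common : Adj G u v → (∀ x → ∃ (NonNeighbour (Adj G) x)) →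
      ∀ i b → ∃ (CommonNonNeighbour (SubAdjSplit G u v 3) (inj₂ i) (inj₁ b))
    internal-original-common uv nonNeighbour zero b with b ≟ v
    ... | no b≢v = inj₂ (suc (suc zero)) , ((λ ()) , λ { (inj₁ ()) ; (inj₂ ()) }) ,
                   ((λ ()) , λ { (inj₁ (_ , ())) ; (inj₂ (b≡v , _)) → b≢v b≡v })
    ... | yes refl with nonNeighbour v
    ...   | b' , b'≢v , ¬v~b' = inj₁ b' ,
            ((λ ()) , λ { (inj₁ (refl , _)) → ¬v~b' (sym G uv) ; (inj₂ (_ , ())) }) ,
            kept-nonNeighbour (b'≢v , ¬v~b')
    internal-original-common uv nonNeighbour (suc zero) b with nonNeighbour b
    ... | b' , b'-nonNeighbour =
      inj₁ b' , ((λ ()) , λ { (inj₁ (_ , ())) ; (inj₂ (_ , ())) }) , kept-nonNeighbour b'-nonNeighbour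
    internal-original-common uv nonNeighbour (suc (suc zero)) b with b ≟ u
    ... | no b≢u = inj₂ zero , ((λ ()) , λ { (inj₁ ()) ; (inj₂ ()) }) ,
                   ((λ ()) , λ { (inj₁ (b≡u , _)) → b≢u b≡u ; (inj₂ (_ , ())) })
    ... | yes refl with nonNeighbour u
    ...   | b' , b'≢u , ¬u~b' = inj₁ b' ,
            ((λ ()) , λ { (inj₁ (_ , ())) ; (inj₂ (refl , _)) → ¬u~b' uv }) ,
            kept-nonNeighbour (b'≢u , ¬u~b')

  subdivision₃-commonNonNeighbours : ∀ {o₃} → Adj G u v → (∀ x → ∃ (NonNeighbour (Adj G) x)) →
    o₃ ≢ u → o₃ ≢ v → ∀ x y → ∃ (CommonNonNeighbour (SubAdjSplit G u v 3) x y)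
  subdivision₃-commonNonNeighbours uv nonNeighbour _ _ (inj₁ a) (inj₁ b) =
    inj₂ (suc zero) , w₁-far-from-originals a , w₁-far-from-originals b
  subdivision₃-commonNonNeighbours uv nonNeighbour _ _ (inj₂ i) (inj₁ b) =
    internal-original-common uv nonNeighbour i b
  subdivision₃-commonNonNeighbours uv nonNeighbour _ _ (inj₁ a) (inj₂ i)
    with internal-original-common uv nonNeighbour i a
  ... | w , i-far , a-far = w , a-far , i-far
  subdivision₃-commonNonNeighbours {o₃} uv _ o₃≢u o₃≢v (inj₂ i) (inj₂ j) =
    inj₁ o₃ , ((λ ()) , internal-nonAdjacent i o₃≢u o₃≢v) , ((λ ()) , internal-nonAdjacent j o₃≢u o₃≢v)

module EdgeDominatedGraph (G : Graph)
    (ends-dominate : ∀ {u v} → Adj G u v → DominatingList (Adj G) (u ∷ v ∷ []))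
    (nonNeighbour : ∀ x → ∃ (NonNeighbour (Adj G) x)) where

  offEdge : ∀ {u v} → Adj G u v → ∃[ o ] o ≢ u × o ≢ v
  offEdge {u} uv with nonNeighbour u
  ... | o , o≢u , ¬u~o = o , o≢u , λ { refl → ¬u~o uv }

  γ≡2 : ∀ {u v} → Adj G u v → IsDomNum G 2
  γ≡2 {u} {v} uv =
    isDomNum G (u ∷ v ∷ []) (ends-dominate uv) ≤-refl (noDominatingListBelow-2 _ u nonNeighbour)

  subdivision-γ≡2 : ∀ {u v t} → Adj G u v → t ≤ 2 → IsDomNum (Subdivide G u v t) 2
  subdivision-γ≡2 {u} {v} {t} uv t≤2 with offEdge uv
  ... | o₃ , o₃≢u , o₃≢v =
    subdivision-isDomNum G u v t (inj₁ u ∷ inj₁ v ∷ [])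
      (ends-dominate-subdivision G (ends-dominate uv) t≤2) ≤-refl
      (noDominatingListBelow-2 _ (inj₁ u)
        (subdivision-nonNeighbours G o₃≢u o₃≢v (map₂ (kept-nonNeighbour G) ∘ nonNeighbour)))

  subdivision₃-γ≡3 : ∀ {u v} → Adj G u v → IsDomNum (Subdivide G u v 3) 3
  subdivision₃-γ≡3 {u} {v} uv with offEdge uv
  ... | o₃ , o₃≢u , o₃≢v =
    subdivision-isDomNum G u v 3 (inj₁ u ∷ inj₁ v ∷ inj₂ (suc zero) ∷ [])
      (ends-and-middle-dominate-subdivision₃ G (ends-dominate uv)) ≤-refl
      (noDominatingListBelow-3 _ (inj₁ u)
        (subdivision₃-commonNonNeighbours G uv nonNeighbour o₃≢u o₃≢v))

  msd≡3 : ∀ {u v} → Adj G u v → IsMsd G 3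
  msd≡3 uv = isMsd uv (s≤s z≤n) (3 , 2 , subdivision₃-γ≡3 uv , γ≡2 uv , ≤-refl) notIncreased
    where
    notIncreased : ∀ u v → Adj G u v → ∀ s → 1 ≤ s → s < 3 →
      GammaNotIncreased (Subdivide G u v s) G
    notIncreased _ _ uv _ _ s<3 = 2 , 2 , subdivision-γ≡2 uv (≤-pred s<3) , γ≡2 uv , ≤-refl

differsFromOneOf : ∀ (a b c : Side) → a ≢ b → a ≢ c ⊎ b ≢ c
differsFromOneOf A A _ a≢b = contradiction refl a≢b
differsFromOneOf B B _ a≢b = contradiction refl a≢b
differsFromOneOf A B A _   = inj₂ λ ()
differsFromOneOf A B B _   = inj₁ λ ()
differsFromOneOf B A A _   = inj₁ λ ()
differsFromOneOf B A B _   = inj₂ λ ()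

K-ends-dominate : ∀ {p q u v} → Adj (K p q) u v → DominatingList (Adj (K p q)) (u ∷ v ∷ [])
K-ends-dominate {p} {q} uv z with differsFromOneOf _ _ (side p q z) uv
... | inj₁ u~z = inj₂ (_ , here refl , u~z)
... | inj₂ v~z = inj₂ (_ , there (here refl) , v~z)

side-↑ʳ : ∀ p q (j : Fin q) → side p q (p ↑ʳ j) ≡ B
side-↑ʳ p q j rewrite splitAt-↑ʳ p q j = refl

module CompleteBipartite (p' q' : ℕ) where

  p q : ℕ
  p = suc (suc p')
  q = suc (suc q')

  twoOnEachSide : ∀ s → ∃₂ λ w w' → w ≢ w' × side p q w ≡ s × side p q w' ≡ s
  twoOnEachSide A = zero , suc zero , (λ ()) , refl , refl
  twoOnEachSide B =
    p ↑ʳ zero , p ↑ʳ suc zero , (λ ()) ∘ ↑ʳ-injective p zero (suc zero) ,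
    side-↑ʳ p q zero , side-↑ʳ p q (suc zero)

  nonNeighbour : ∀ x → ∃ (NonNeighbour (Adj (K p q)) x)
  nonNeighbour x with twoOnEachSide (side p q x)
  ... | w , w' , w≢w' , w-side , w'-side with w ≟ x
  ...   | yes refl = w' , (λ w'≡w → w≢w' (≡-sym w'≡w)) , λ x≁w' → x≁w' (≡-sym w'-side)
  ...   | no w≢x   = w , w≢x , λ x≁w → x≁w (≡-sym w-side)

  msd≡3 : IsMsd (K p q) 3
  msd≡3 = EdgeDominatedGraph.msd≡3 (K p q) K-ends-dominate nonNeighbour {zero} {p ↑ʳ zero}
    λ A≡side → A≢B (trans A≡side (side-↑ʳ p q zero))
    where
    A≢B : A ≢ B
    A≢B ()

K₁-centre-universal : ∀ q z → z ≢ zero → Adj (K 1 q) zero z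
K₁-centre-universal q zero    z≢0 = contradiction refl z≢0
K₁-centre-universal q (suc _) _   = λ ()

star-msd≡1 : ∀ q' → IsMsd (K 1 (suc (suc q'))) 1
star-msd≡1 q' =
  isMsd {u = zero} {v = suc zero} (λ ()) ≤-refl
    (2 , 1 , subdivided , universal⇒γ≡1 G (K₁-centre-universal _) , ≤-refl)
    λ { _ _ _ _ (s≤s _) (s≤s ()) }
  where
  G : Graph
  G = K 1 (suc (suc q'))

  originalNonNeighbour : ∀ o → ∃[ o' ] NonNeighbour (SubAdjSplit G zero (suc zero) 1) (inj₁ o) (inj₁ o')
  originalNonNeighbour zero          = suc zero , (λ ()) , λ c~o' → proj₂ c~o' (inj₁ (refl , refl))
  originalNonNeighbour (suc zero)    = suc (suc zero) , (λ ()) , λ b~o' → proj₁ b~o' refl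
  originalNonNeighbour (suc (suc _)) = suc zero , (λ ()) , λ b~o' → proj₁ b~o' refl

  subdivided : IsDomNum (Subdivide G zero (suc zero) 1) 2
  subdivided =
    subdivision-isDomNum G zero (suc zero) 1 (inj₁ zero ∷ inj₁ (suc zero) ∷ [])
      (ends-dominate-subdivision G (universal-dominates G (K₁-centre-universal _) _) (s≤s z≤n)) ≤-refl
      (noDominatingListBelow-2 _ (inj₁ zero)
        (subdivision-nonNeighbours G {o₃ = suc (suc zero)} (λ ()) (λ ()) originalNonNeighbour))

K₁₁-ends : ∀ {u v} → Adj (K 1 1) u v → ∀ z → z ≡ u ⊎ z ≡ v
K₁₁-ends {zero}     {zero}     uv = contradiction refl uv
K₁₁-ends {suc zero} {suc zero} uv = contradiction refl uv
K₁₁-ends {zero}     {suc zero} _ zero       = inj₁ refl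
K₁₁-ends {zero}     {suc zero} _ (suc zero) = inj₂ refl
K₁₁-ends {suc zero} {zero}     _ zero       = inj₂ refl
K₁₁-ends {suc zero} {zero}     _ (suc zero) = inj₁ refl

K₁₁-msd≡2 : IsMsd (K 1 1) 2
K₁₁-msd≡2 =
  isMsd {u = zero} {v = suc zero} (λ ()) (s≤s z≤n) (2 , 1 , subdivided₂ , γ≡1 , ≤-refl) notIncreased
  where
  γ≡1 : IsDomNum (K 1 1) 1
  γ≡1 = universal⇒γ≡1 (K 1 1) (K₁-centre-universal 1)

  notIncreased : ∀ u v → Adj (K 1 1) u v → ∀ s → 1 ≤ s → s < 2 →
    GammaNotIncreased (Subdivide (K 1 1) u v s) (K 1 1)
  notIncreased u v uv (suc zero) _ _ =
    1 , 1 ,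
    subdivision-isDomNum _ u v 1 (inj₂ zero ∷ []) (middle-dominates-subdivision₁ _ (K₁₁-ends uv)) ≤-refl
      (noDominatingListBelow-1 _ (inj₂ zero)) ,
    γ≡1 , ≤-refl
  notIncreased _ _ _ (suc (suc _)) _ (s≤s (s≤s ()))

  pathNonNeighbour : ∀ x → ∃ (NonNeighbour (SubAdjSplit (K 1 1) zero (suc zero) 2) x)
  pathNonNeighbour (inj₁ zero)       = inj₁ (suc zero) , (λ ()) , λ u~v → proj₂ u~v (inj₁ (refl , refl))
  pathNonNeighbour (inj₁ (suc zero)) = inj₁ zero , (λ ()) , λ v~u → proj₂ v~u (inj₂ (refl , refl))
  pathNonNeighbour (inj₂ zero)       = inj₁ (suc zero) , (λ ()) , λ { (inj₁ (() , _)) ; (inj₂ (_ , ())) }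
  pathNonNeighbour (inj₂ (suc zero)) = inj₁ zero , (λ ()) , λ { (inj₁ (_ , ())) ; (inj₂ (() , _)) }

  subdivided₂ : IsDomNum (Subdivide (K 1 1) zero (suc zero) 2) 2
  subdivided₂ =
    subdivision-isDomNum _ zero (suc zero) 2 (inj₁ zero ∷ inj₁ (suc zero) ∷ [])
      (ends-dominate-subdivision _ (universal-dominates (K 1 1) (K₁-centre-universal 1) _) ≤-refl) ≤-refl
      (noDominatingListBelow-2 _ (inj₁ zero) pathNonNeighbour)

proposition1 : (p q : ℕ) → 1 ≤ p → p ≤ q →
    ((p ≡ 1 → 1 < q → IsMsd (K p q) 1) ×
     (p ≡ 1 → q ≡ 1 → IsMsd (K p q) 2) ×
     (2 ≤ p → IsMsd (K p q) 3))
proposition1 (suc zero) (suc zero) _ _ =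
  (λ _ → λ { (s≤s ()) }) , (λ _ _ → K₁₁-msd≡2) , λ { (s≤s ()) }
proposition1 (suc zero) (suc (suc q')) _ _ =
  (λ _ _ → star-msd≡1 q') , (λ _ ()) , λ { (s≤s ()) }
proposition1 (suc (suc p')) (suc (suc q')) _ _ =
  (λ ()) , (λ ()) , λ _ → CompleteBipartite.msd≡3 p' q'
proposition1 (suc (suc _)) (suc zero) _ (s≤s ())
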